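{- In the segment construction described in the context, let $v$ be the first node of a segment. Then $g(v-1)\le y([1,v-1])$, and the segment rule $g(v+r^*-1)\le y([1,v-1])+\frac1w$ holds for $r^*=r$.
   Context: Let $k\ge2$ and $n>2^k$ be integers, $c=2^k-2$, with $\gcd(c,n-1)=1$, and let $V=\{0,\dots,n-1\}$. Let $h,w$ be the positive integers with $h(n-1)-wc=1$ and $0<w\le n-2$ minimal. Define $g(v)=v\cdot\frac{h}{wc}$ and $r=\lfloor c/h\rfloor$. For integers $a\le b$ in $[0,n-1]$, $[a,b]=\{a,\dots,b\}$ (and $[a,b]=\emptyset$ if $a>b$), and $y(S)=\sum_{v\in S}y_v$. Segment construction of $y\in\mathbb R^V$: set $y_0=y_{n-1}=0$; starting with $v=1$, repeatedly let $r^*$ be the largest element of $\{r,r+1\}$ with $g(v+r^*-1)\le y([1,v-1])+\frac1w$ (segment rule; $y([1,v-1])$ is the mass already assigned to $1,\dots,v-1$), call $\{v,\dots,v+r^*-1\}$ a segment (with first node $v$), set $y_i=\frac{1}{r^*w}$ for $i=v,\dots,v+r^*-1$, and set $v:=v+r^*$; stop when $v>n-2$. -}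

module Defs where

open import Data.Nat as ℕ using (ℕ; zero; suc; _∸_; _^_)
import Data.Nat.DivMod as ℕD
open import Data.Integer using (+_)
open import Data.Rational using (ℚ; 0ℚ; _/_; _+_; _≤ᵇ_)
open import Data.List using (List; []; _∷_; _++_; map; foldr; upTo)
open import Data.Bool using (Bool; true; false; if_then_else_)

cOf : ℕ → ℕ
cOf k = 2 ^ k ∸ 2

-- a / b as a rational (b = 0 never occurs under the hypotheses; fallback 0)
frac : ℕ → ℕ → ℚ
frac a zero    = 0ℚ
frac a (suc b) = (+ a) / suc b

-- floor division on ℕ (b = 0 never occurs under the hypotheses; fallback 0)
divℕ : ℕ → ℕ → ℕ
divℕ a zero    = 0
divℕ a (suc b) = a ℕD./ suc b

gfun : (k h w : ℕ) → ℕ → ℚ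
gfun k h w v = frac (v ℕ.* h) (w ℕ.* cOf k)

rOf : (k h : ℕ) → ℕ
rOf k h = divℕ (cOf k) h

record Seg : Set where
  constructor seg
  field
    start : ℕ
    len   : ℕ
open Seg public

yOf : (w : ℕ) → List Seg → ℕ → ℚ
yOf w [] i = 0ℚ
yOf w (seg s l ∷ ss) i =
  if (s ℕ.≤ᵇ i) Data.Bool.∧ (i ℕ.<ᵇ s ℕ.+ l) then frac 1 (l ℕ.* w) else yOf w ss i

massBefore : (w : ℕ) → List Seg → ℕ → ℚ
massBefore w ss v = foldr _+_ 0ℚ (map (λ i → yOf w ss (suc i)) (upTo (v ∸ 1)))

-- the segment construction; `fuel` bounds the number of steps (n steps suffice)
build : (n k h w : ℕ) → (fuel : ℕ) → (v : ℕ) → List Seg → List Seg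
build n k h w zero v acc = acc
build n k h w (suc fuel) v acc =
  if (n ∸ 2) ℕ.<ᵇ v then acc
  else build n k h w fuel (v ℕ.+ rstar) (acc ++ (seg v rstar ∷ []))
  where
    r = rOf k h
    rstar : ℕ
    rstar = if gfun k h w (v ℕ.+ suc r ∸ 1) ≤ᵇ (massBefore w acc v + frac 1 w)
            then suc r else r

segments : (n k h w : ℕ) → List Seg
segments n k h w = build n k h w n 1 []

yFinal : (n k h w : ℕ) → ℕ → ℚ
yFinal n k h w = yOf w (segments n k h w)

firstNodes : (n k h w : ℕ) → List ℕ
firstNodes n k h w = map start (segments n k h w)

-- Each segment of length r* carries mass exactly 1/w. So if g(v-1) ≤ y([1,v-1]) holds at the
-- first node v of a segment, then at the next first node v + r* the mass has grown by 1/w while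
-- g(v + r* - 1) ≤ y([1,v-1]) + 1/w: for r* = r+1 this is the segment rule, and for r* = r it is
-- the shift bound g(x + r) ≤ g(x) + 1/w, which holds because r h ≤ c. The same shift bound
-- turns the invariant at a first node into the segment rule for r* = r.
module Submission where

open import Defs
open import Data.Nat using (ℕ; _∸_; _^_; _≤_; _<_)
open import Data.Nat.GCD using (gcd)
open import Data.Product using (_×_)
open import Data.List.Membership.Propositional using (_∈_)
open import Relation.Binary.PropositionalEquality using (_≡_)
import Data.Nat as N
import Data.Rational as Q

open N using (zero; suc; s≤s; z≤n)
import Data.Nat.Properties as NP
import Data.Nat.DivMod as ND
import Data.Integer as Z
import Data.Integer.Properties as ZP
open Q using (ℚ; 0ℚ; _+_)
import Data.Rational.Properties as QP
open import Data.Rational.Unnormalised as U using (mkℚᵘ; *≡*; *≤*)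
import Data.Rational.Unnormalised.Properties as UP
open import Relation.Binary.PropositionalEquality
  using (refl; sym; trans; cong; cong₂; subst; subst₂; module ≡-Reasoning)
open import Data.List using (List; []; _∷_; _++_; map; foldr; upTo; [_])
import Data.List.Properties as LP
open import Data.List.Relation.Unary.All as All using (All; []; _∷_)
import Data.List.Relation.Unary.All.Properties as AllP
import Data.List.Membership.Propositional.Properties as LMP
open import Data.Bool using (true; false; T; if_then_else_; _∧_)
open import Data.Unit using (tt)
open import Data.Empty using (⊥-elim)
open import Data.Product using (_,_; ∃)

mkℚᵘ-≃ : ∀ a m b n → a N.* suc n ≡ b N.* suc m → mkℚᵘ (Z.+ a) m U.≃ mkℚᵘ (Z.+ b) n
mkℚᵘ-≃ a m b n eq = *≡* (trans (sym (ZP.pos-* a (suc n))) (trans (cong Z.+_ eq) (ZP.pos-* b (suc m))))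

mkℚᵘ-≤ : ∀ a m b n → a N.* suc n ≤ b N.* suc m → mkℚᵘ (Z.+ a) m U.≤ mkℚᵘ (Z.+ b) n
mkℚᵘ-≤ a m b n le = *≤* (subst₂ Z._≤_ (ZP.pos-* a (suc n)) (ZP.pos-* b (suc m)) (Z.+≤+ le))

mkℚᵘ-+ : ∀ a m b n → mkℚᵘ (Z.+ a) m U.+ mkℚᵘ (Z.+ b) n
       ≡ mkℚᵘ (Z.+ (a N.* suc n N.+ b N.* suc m)) (n N.+ m N.* suc n)
mkℚᵘ-+ a m b n rewrite sym (ZP.pos-* a (suc n)) | sym (ZP.pos-* b (suc m)) = refl

toℚᵘ-frac : ∀ a m → Q.toℚᵘ (frac a (suc m)) U.≃ mkℚᵘ (Z.+ a) m
toℚᵘ-frac a m = QP.toℚᵘ-fromℚᵘ (mkℚᵘ (Z.+ a) m)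

frac-cong : ∀ a m b n → 0 < m → 0 < n → a N.* n ≡ b N.* m → frac a m ≡ frac b n
frac-cong a (suc m) b (suc n) _ _ eq = QP.fromℚᵘ-cong (mkℚᵘ-≃ a m b n eq)

frac-monoˡ-≤ : ∀ {a b} m → a ≤ b → frac a m Q.≤ frac b m
frac-monoˡ-≤ zero    _  = QP.≤-refl
frac-monoˡ-≤ {a} {b} (suc m) le = QP.toℚᵘ-cancel-≤
  (UP.≤-respʳ-≃ (UP.≃-sym (toℚᵘ-frac b m)) (UP.≤-respˡ-≃ (UP.≃-sym (toℚᵘ-frac a m))
    (mkℚᵘ-≤ a m b m (NP.*-monoˡ-≤ (suc m) le))))

frac-zero : ∀ m → frac 0 m ≡ 0ℚ
frac-zero zero    = refl
frac-zero (suc m) = QP.0/n≡0 (suc m)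

frac-+ : ∀ a b {m} → 0 < m → frac a m + frac b m ≡ frac (a N.+ b) m
frac-+ a b {suc m} _ = begin
  frac a (suc m) + frac b (suc m)
    ≡⟨ QP.toℚᵘ-injective (UP.≃-trans (QP.toℚᵘ-homo-+ (frac a (suc m)) (frac b (suc m)))
         (UP.≃-trans (UP.+-cong (toℚᵘ-frac a m) (toℚᵘ-frac b m))
           (UP.≃-trans (UP.≃-reflexive (mkℚᵘ-+ a m b m)) (UP.≃-sym (toℚᵘ-frac _ _))))) ⟩
  frac (a N.* suc m N.+ b N.* suc m) (suc m N.* suc m)
    ≡⟨ frac-cong (a N.* suc m N.+ b N.* suc m) (suc m N.* suc m) (a N.+ b) (suc m) (s≤s z≤n) (s≤s z≤n) cross ⟩
  frac (a N.+ b) (suc m) ∎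
  where
  open ≡-Reasoning
  cross : (a N.* suc m N.+ b N.* suc m) N.* suc m ≡ (a N.+ b) N.* (suc m N.* suc m)
  cross = trans (cong (N._* suc m) (sym (NP.*-distribʳ-+ (suc m) a b))) (NP.*-assoc (a N.+ b) (suc m) (suc m))

prefixSum : (ℕ → ℚ) → ℕ → ℚ
prefixSum f n = foldr _+_ 0ℚ (map f (upTo n))

foldr-+-init : ∀ (xs : List ℚ) x → foldr _+_ x xs ≡ foldr _+_ 0ℚ xs + x
foldr-+-init []       x = sym (QP.+-identityˡ x)
foldr-+-init (y ∷ xs) x = trans (cong (y +_) (foldr-+-init xs x)) (sym (QP.+-assoc y _ x))

prefixSum-suc : ∀ f n → prefixSum f (suc n) ≡ prefixSum f n + f n
prefixSum-suc f n = begin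
  foldr _+_ 0ℚ (map f (upTo (suc n)))      ≡⟨ cong (λ l → foldr _+_ 0ℚ (map f l)) (sym (LP.upTo-∷ʳ n)) ⟩
  foldr _+_ 0ℚ (map f (upTo n ++ [ n ]))   ≡⟨ cong (foldr _+_ 0ℚ) (LP.map-++ f (upTo n) [ n ]) ⟩
  foldr _+_ 0ℚ (map f (upTo n) ++ [ f n ]) ≡⟨ LP.foldr-++ _+_ 0ℚ (map f (upTo n)) [ f n ] ⟩
  foldr _+_ (f n + 0ℚ) (map f (upTo n))    ≡⟨ foldr-+-init (map f (upTo n)) _ ⟩
  prefixSum f n + (f n + 0ℚ)               ≡⟨ cong (prefixSum f n +_) (QP.+-identityʳ (f n)) ⟩
  prefixSum f n + f n                      ∎
  where open ≡-Reasoning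

prefixSum-cong : ∀ f f′ n → (∀ i → i < n → f i ≡ f′ i) → prefixSum f n ≡ prefixSum f′ n
prefixSum-cong f f′ zero    eq = refl
prefixSum-cong f f′ (suc n) eq = begin
  prefixSum f (suc n)      ≡⟨ prefixSum-suc f n ⟩
  prefixSum f n + f n      ≡⟨ cong₂ _+_ (prefixSum-cong f f′ n (λ i i<n → eq i (NP.m≤n⇒m≤1+n i<n))) (eq n NP.≤-refl) ⟩
  prefixSum f′ n + f′ n    ≡⟨ sym (prefixSum-suc f′ n) ⟩
  prefixSum f′ (suc n)     ∎
  where open ≡-Reasoning

prefixSum-run : ∀ f v t {d} → 0 < d → (∀ i → v ≤ i → i < v N.+ t → f i ≡ frac 1 d) →
                prefixSum f (v N.+ t) ≡ prefixSum f v + frac t d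
prefixSum-run f v zero    {d} _   _   rewrite NP.+-identityʳ v =
  sym (trans (cong (prefixSum f v +_) (frac-zero d)) (QP.+-identityʳ (prefixSum f v)))
prefixSum-run f v (suc t) {d} d>0 run = begin
  prefixSum f (v N.+ suc t)                   ≡⟨ cong (prefixSum f) (NP.+-suc v t) ⟩
  prefixSum f (suc (v N.+ t))                 ≡⟨ prefixSum-suc f (v N.+ t) ⟩
  prefixSum f (v N.+ t) + f (v N.+ t)         ≡⟨ cong₂ _+_ (prefixSum-run f v t d>0 run′) (run (v N.+ t) (NP.m≤m+n v t) (NP.+-monoʳ-< v NP.≤-refl)) ⟩
  prefixSum f v + frac t d + frac 1 d         ≡⟨ QP.+-assoc (prefixSum f v) _ _ ⟩
  prefixSum f v + (frac t d + frac 1 d)       ≡⟨ cong (prefixSum f v +_) (frac-+ t 1 d>0) ⟩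
  prefixSum f v + frac (t N.+ 1) d            ≡⟨ cong (λ x → prefixSum f v + frac x d) (NP.+-comm t 1) ⟩
  prefixSum f v + frac (suc t) d              ∎
  where
  open ≡-Reasoning
  run′ : ∀ i → v ≤ i → i < v N.+ t → f i ≡ frac 1 d
  run′ i v≤i i<v+t = run i v≤i (NP.<-≤-trans i<v+t (NP.+-monoʳ-≤ v (NP.n≤1+n t)))

yOf-before : ∀ w ss i → All (λ s → i < start s) ss → yOf w ss i ≡ 0ℚ
yOf-before w []             i _          = refl
yOf-before w (seg s l ∷ ss) i (i<s ∷ ss>i) with s N.≤ᵇ i in s≤ᵇi
... | true  = ⊥-elim (NP.<⇒≱ i<s (NP.≤ᵇ⇒≤ s i (subst T (sym s≤ᵇi) tt)))
... | false = yOf-before w ss i ss>i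

yOf-++-before : ∀ w ss ss′ i → All (λ s → i < start s) ss′ → yOf w (ss ++ ss′) i ≡ yOf w ss i
yOf-++-before w []             ss′ i ss′>i = yOf-before w ss′ i ss′>i
yOf-++-before w (seg s l ∷ ss) ss′ i ss′>i with (s N.≤ᵇ i) ∧ (i N.<ᵇ s N.+ l)
... | true  = refl
... | false = yOf-++-before w ss ss′ i ss′>i

yOf-++-after : ∀ w ss ss′ i → All (λ s → start s N.+ len s ≤ i) ss → yOf w (ss ++ ss′) i ≡ yOf w ss′ i
yOf-++-after w []             ss′ i _ = refl
yOf-++-after w (seg s l ∷ ss) ss′ i (s+l≤i ∷ ss<i) with s N.≤ᵇ i | i N.<ᵇ s N.+ l in i<ᵇs+l
... | false | _     = yOf-++-after w ss ss′ i ss<i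
... | true  | false = yOf-++-after w ss ss′ i ss<i
... | true  | true  = ⊥-elim (NP.<⇒≱ (NP.<ᵇ⇒< i (s N.+ l) (subst T (sym i<ᵇs+l) tt)) s+l≤i)

yOf-inside : ∀ w s l i → s ≤ i → i < s N.+ l → yOf w [ seg s l ] i ≡ frac 1 (l N.* w)
yOf-inside w s l i s≤i i<s+l with s N.≤ᵇ i in s≤ᵇi | i N.<ᵇ s N.+ l in i<ᵇs+l
... | true  | true  = refl
... | false | _     = ⊥-elim (subst T s≤ᵇi (NP.≤⇒≤ᵇ s≤i))
... | true  | false = ⊥-elim (subst T i<ᵇs+l (NP.<⇒<ᵇ i<s+l))

module SegmentConstruction (k h w : ℕ) (w>0 : 0 < w) (c>0 : 0 < cOf k)
                           (r*h≤c : rOf k h N.* h ≤ cOf k) (r>0 : 0 < rOf k h) where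

  g : ℕ → ℚ
  g = gfun k h w

  r c : ℕ
  r = rOf k h
  c = cOf k

  mass : List Seg → ℕ → ℚ
  mass = massBefore w

  g-+r : ∀ x → g (x N.+ r) Q.≤ g x + frac 1 w
  g-+r x = begin
    frac ((x N.+ r) N.* h) (w N.* c)       ≡⟨ cong (λ a → frac a (w N.* c)) (NP.*-distribʳ-+ h x r) ⟩
    frac (x N.* h N.+ r N.* h) (w N.* c)   ≡⟨ sym (frac-+ (x N.* h) (r N.* h) wc>0) ⟩
    g x + frac (r N.* h) (w N.* c)         ≤⟨ QP.+-monoʳ-≤ (g x) (frac-monoˡ-≤ (w N.* c) r*h≤c) ⟩
    g x + frac c (w N.* c)                 ≡⟨ cong (g x +_) (frac-cong c (w N.* c) 1 w wc>0 w>0 c*w≡1*wc) ⟩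
    g x + frac 1 w                         ∎
    where
    open QP.≤-Reasoning
    wc>0 : 0 < w N.* c
    wc>0 = NP.*-mono-≤ w>0 c>0
    c*w≡1*wc : c N.* w ≡ 1 N.* (w N.* c)
    c*w≡1*wc = trans (NP.*-comm c w) (sym (NP.*-identityˡ (w N.* c)))

  Dominated : List Seg → ℕ → Set
  Dominated ss v = g (v ∸ 1) Q.≤ mass ss v

  -- v is the last node covered by ss, so the next first node is suc v.
  record Invariant (ss : List Seg) (v : ℕ) : Set where
    field
      ends-by          : All (λ s → start s N.+ len s ≤ suc v) ss
      starts-dominated : All (λ s → 1 ≤ start s × Dominated ss (start s)) ss
      next-dominated   : Dominated ss (suc v)
  open Invariant

  Admissible : List Seg → ℕ → ℕ → Set
  Admissible ss v l = 0 < l × g (v N.+ l) Q.≤ mass ss (suc v) + frac 1 w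

  mass-snoc-before : ∀ ss v l x → x ≤ suc v → mass (ss ++ [ seg (suc v) l ]) x ≡ mass ss x
  mass-snoc-before ss v l x x≤1+v = prefixSum-cong _ _ (x ∸ 1) λ i i<x∸1 →
    yOf-++-before w ss _ (suc i) (s≤s (NP.≤-trans i<x∸1 (NP.∸-monoˡ-≤ 1 x≤1+v)) ∷ [])

  mass-snoc-after : ∀ ss v l → All (λ s → start s N.+ len s ≤ suc v) ss → 0 < l →
                    mass (ss ++ [ seg (suc v) l ]) (suc (v N.+ l)) ≡ mass ss (suc v) + frac 1 w
  mass-snoc-after ss v l ends l>0 = begin
    prefixSum y (v N.+ l)                 ≡⟨ prefixSum-run y v l lw>0 inside ⟩
    prefixSum y v + frac l (l N.* w)      ≡⟨ cong₂ _+_ (mass-snoc-before ss v l (suc v) NP.≤-refl) l/lw≡1/w ⟩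
    mass ss (suc v) + frac 1 w            ∎
    where
    open ≡-Reasoning
    y : ℕ → ℚ
    y i = yOf w (ss ++ [ seg (suc v) l ]) (suc i)
    lw>0 : 0 < l N.* w
    lw>0 = NP.*-mono-≤ l>0 w>0
    inside : ∀ i → v ≤ i → i < v N.+ l → y i ≡ frac 1 (l N.* w)
    inside i v≤i i<v+l = trans
      (yOf-++-after w ss _ (suc i) (All.map (λ end≤ → NP.≤-trans end≤ (s≤s v≤i)) ends))
      (yOf-inside w (suc v) l (suc i) (s≤s v≤i) (s≤s i<v+l))
    l/lw≡1/w : frac l (l N.* w) ≡ frac 1 w
    l/lw≡1/w = frac-cong l (l N.* w) 1 w lw>0 w>0 (sym (NP.*-identityˡ (l N.* w)))

  invariant-snoc : ∀ ss v l → Invariant ss v → Admissible ss v l → Invariant (ss ++ [ seg (suc v) l ]) (v N.+ l)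
  invariant-snoc ss v l inv (l>0 , rule) = record
    { ends-by          = AllP.++⁺ (All.map (λ end≤ → NP.≤-trans end≤ (s≤s (NP.m≤m+n v l))) (ends-by inv))
                                  (NP.≤-refl ∷ [])
    ; starts-dominated = AllP.++⁺ (All.zipWith old (ends-by inv , starts-dominated inv))
                                  ((s≤s z≤n , preserved (suc v) NP.≤-refl (next-dominated inv)) ∷ [])
    ; next-dominated   = QP.≤-trans rule (QP.≤-reflexive (sym (mass-snoc-after ss v l (ends-by inv) l>0)))
    }
    where
    preserved : ∀ x → x ≤ suc v → Dominated ss x → Dominated (ss ++ [ seg (suc v) l ]) x
    preserved x x≤1+v = subst (g (x ∸ 1) Q.≤_) (sym (mass-snoc-before ss v l x x≤1+v))
    old : ∀ {s} → start s N.+ len s ≤ suc v × (1 ≤ start s × Dominated ss (start s)) →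
          1 ≤ start s × Dominated (ss ++ [ seg (suc v) l ]) (start s)
    old {seg s l′} (end≤ , s>0 , dom) = s>0 , preserved s (NP.≤-trans (NP.m≤m+n s l′) end≤) dom

  -- Definitionally the length r* that `build` chooses at the first node suc v.
  chosenLength : List Seg → ℕ → ℕ
  chosenLength ss v = if g (v N.+ suc r) Q.≤ᵇ (mass ss (suc v) + frac 1 w) then suc r else r

  chosenLength-admissible : ∀ ss v → Invariant ss v → Admissible ss v (chosenLength ss v)
  chosenLength-admissible ss v inv with g (v N.+ suc r) Q.≤ᵇ (mass ss (suc v) + frac 1 w) in rule
  ... | true  = s≤s z≤n , QP.≤ᵇ⇒≤ (subst T (sym rule) tt)
  ... | false = r>0 , QP.≤-trans (g-+r v) (QP.+-monoˡ-≤ (frac 1 w) (next-dominated inv))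

  build-invariant : ∀ n fuel v ss → Invariant ss v → ∃ (Invariant (build n k h w fuel (suc v) ss))
  build-invariant n zero       v ss inv = v , inv
  build-invariant n (suc fuel) v ss inv with n ∸ 2 N.<ᵇ suc v
  ... | true  = v , inv
  ... | false = build-invariant n fuel (v N.+ chosenLength ss v) _
                  (invariant-snoc ss v _ inv (chosenLength-admissible ss v inv))

  segments-invariant : ∀ n → ∃ (Invariant (segments n k h w))
  segments-invariant n = build-invariant n n 0 [] record
    { ends-by = [] ; starts-dominated = [] ; next-dominated = QP.≤-reflexive (frac-zero (w N.* c)) }

  firstNode-bounds : ∀ n v → v ∈ firstNodes n k h w →
    Dominated (segments n k h w) v × g (v N.+ r ∸ 1) Q.≤ mass (segments n k h w) v + frac 1 w
  firstNode-bounds n v v∈ with segments-invariant n | LMP.∈-map⁻ start v∈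
  ... | _ , inv | s , s∈ , refl with All.lookup (starts-dominated inv) s∈
  ... | s≤s {_} {v-1} _ , dom = dom , QP.≤-trans (g-+r v-1) (QP.+-monoˡ-≤ (frac 1 w) dom)

bezout-coefficient-≤ : ∀ c m h w → 0 < w → w < m → h N.* m ≡ 1 N.+ w N.* c → h ≤ c
bezout-coefficient-≤ c m h w w>0 w<m eq = NP.≤-pred (NP.*-cancelʳ-< m h (suc c) h*m<[1+c]*m)
  where
  open NP.≤-Reasoning
  h*m<[1+c]*m : h N.* m < suc c N.* m
  h*m<[1+c]*m = begin-strict
    h N.* m        ≡⟨ eq ⟩
    1 N.+ w N.* c  <⟨ NP.+-mono-<-≤ (NP.<-≤-trans (s≤s w>0) w<m) (NP.*-monoˡ-≤ c (NP.<⇒≤ w<m)) ⟩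
    m N.+ m N.* c  ≡⟨ cong (m N.+_) (NP.*-comm m c) ⟩
    suc c N.* m    ∎

lemma3p4 : (k n h w : ℕ) → 2 ≤ k → 2 ^ k < n → gcd (cOf k) (n ∸ 1) ≡ 1
    → 0 < h → 0 < w → w ≤ n ∸ 2 → h N.* (n ∸ 1) ≡ 1 N.+ w N.* cOf k
    → ((h′ w′ : ℕ) → 0 < h′ → 0 < w′ → h′ N.* (n ∸ 1) ≡ 1 N.+ w′ N.* cOf k → w ≤ w′)
    → (v : ℕ) → v ∈ firstNodes n k h w
    → (gfun k h w (v ∸ 1) Q.≤ massBefore w (segments n k h w) v)
    × (gfun k h w (v N.+ rOf k h ∸ 1) Q.≤ massBefore w (segments n k h w) v Q.+ frac 1 w)
-- The missing cases n < 2 and h = 0 are absurd by 0 < w ≤ n ∸ 2 and 0 < h.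
lemma3p4 k (suc (suc n-2)) h@(suc _) w _ _ _ _ w>0 w≤n-2 bezout _ =
  SegmentConstruction.firstNode-bounds k h w w>0 (NP.<-≤-trans (s≤s z≤n) h≤c)
    (ND.m/n*n≤m (cOf k) h) (ND.m≥n⇒m/n>0 h≤c) (suc (suc n-2))
  where
  h≤c : h ≤ cOf k
  h≤c = bezout-coefficient-≤ (cOf k) (suc n-2) h w w>0 (s≤s w≤n-2) bezout
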